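{- Let $Q,R,S\in\mathfrak{P}$. If $Q\times R\sqsubseteq Q\times S$, then $R\sqsubseteq S$.
   Context: $\mathfrak{P}$ is the class of finite nonempty posets and $\mathfrak{P}_r$ a fixed system of representatives of its isomorphism classes. $\mathcal{H}(P,Q)$ is the set of order-preserving maps $P\to Q$. $Q\times R$ is the product poset with componentwise order. For $R,S\in\mathfrak{P}$, $R\sqsubseteq S$ means that there exists a strong Hom-scheme from $R$ to $S$, i.e., a family $(\rho_P)_{P\in\mathfrak{P}_r}$ of injective maps $\rho_P:\mathcal{H}(P,R)\to\mathcal{H}(P,S)$ (equivalently, $\#\mathcal{H}(P,R)\le\#\mathcal{H}(P,S)$ for all $P\in\mathfrak{P}$). -}

module Defs where

open import Data.Nat using (ℕ; suc; _*_; _+_)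
open import Data.Fin using (Fin; remQuot)
open import Data.Bool as Bool using (Bool; T; _∧_; _∨_; not)
open import Data.Vec using (Vec; lookup)
open import Data.List using (List; []; _∷_; allFin)
open import Data.Product using (Σ; _×_; _,_; proj₁; proj₂)
open import Relation.Binary.PropositionalEquality using (_≡_)
open import Function.Definitions using (Injective)

record RawFinPoset : Set where
  field
    size : ℕ                                   -- (number of elements) - 1
    le   : Fin (suc size) → Fin (suc size) → Bool

open RawFinPoset public

Elem : RawFinPoset → Set
Elem P = Fin (suc (size P))

record IsPoset (P : RawFinPoset) : Set where
  field
    reflexive : ∀ x → T (le P x x)
    antisym   : ∀ x y → T (le P x y) → T (le P y x) → x ≡ y
    transitive : ∀ x y z → T (le P x y) → T (le P y z) → T (le P x z)

allL : {A : Set} → (A → Bool) → List A → Bool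
allL p [] = Bool.true
allL p (x ∷ xs) = p x ∧ allL p xs

-- A map P → R is represented by its table of values (a vector indexed by Elem P).
isMono : (P R : RawFinPoset) → Vec (Elem R) (suc (size P)) → Bool
isMono P R v =
  allL (λ x → allL (λ y → not (le P x y) ∨ le R (lookup v x) (lookup v y))
                 (allFin (suc (size P))))
      (allFin (suc (size P)))

Hom : RawFinPoset → RawFinPoset → Set
Hom P R = Σ (Vec (Elem R) (suc (size P))) (λ v → T (isMono P R v))

-- Product poset Q × R with componentwise order; the carrier
-- Fin (suc (size Q) * suc (size R)) is identified with Elem Q × Elem R via remQuot.
_×ₚ_ : RawFinPoset → RawFinPoset → RawFinPoset
Q ×ₚ R = record
  { size = size R + size Q * suc (size R)
  ; le   = λ i j →
      let a = remQuot {suc (size Q)} (suc (size R)) i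
          b = remQuot {suc (size Q)} (suc (size R)) j
      in le Q (proj₁ a) (proj₁ b) ∧ le R (proj₂ a) (proj₂ b)
  }

_⊑_ : RawFinPoset → RawFinPoset → Set
R ⊑ S = (P : RawFinPoset) → IsPoset P →
        Σ (Hom P R → Hom P S) (Injective _≡_ _≡_)

-- Every Hom-set H(P, X) is finite, and H(P, Q × X) ≅ H(P, Q) × H(P, X).
-- A Hom-scheme from Q × R to Q × S therefore gives, for each P,
-- #H(P,Q) · #H(P,R) ≤ #H(P,Q) · #H(P,S), while #H(P,Q) ≥ 1 because the
-- constant maps into Q are order-preserving; cancelling gives #H(P,R) ≤ #H(P,S).
module Submission where

open import Defs
open import Data.Nat using (ℕ; zero; suc; _+_; _*_; _≤_)
open import Data.Nat.Properties using (*-cancelˡ-≤)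
open import Data.Fin using (Fin; zero; suc; remQuot)
open import Data.Fin.Properties
  using (*↔×; +↔⊎; 0↔⊥; 1↔⊤; injective⇒≤; inject≤-injective; nonZeroIndex)
open import Data.Bool using (Bool; true; false; T; _∨_; not)
open import Data.Bool.Properties using (T-∧; T-irrelevant)
open import Data.Empty using (⊥)
open import Data.Unit using (⊤)
open import Data.Sum using (_⊎_; inj₁; inj₂)
open import Data.Product using (Σ; ∃-syntax; _×_; _,_; proj₁; proj₂)
open import Data.Product.Properties using (×-≡,≡→≡)
open import Data.Product.Function.NonDependent.Propositional using (_×-↔_; _×-⇔_)
open import Data.Product.Function.Dependent.Propositional using (Σ-↔)
open import Data.Sum.Function.Propositional using (_⊎-↔_)
open import Data.Vec using (Vec; []; _∷_; lookup; map; replicate)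
open import Data.Vec.Properties
  using (map-∘; map-id; map-cong; lookup-map; lookup-unzip; lookup-replicate; ×v↔v×)
open import Data.List using (tabulate; allFin)
open import Function using (_∘_)
open import Function.Bundles using (Inverse; _↔_; _⇔_; _↣_; mk↔ₛ′; mk⇔; mk↣; Injection; Equivalence)
open import Function.Properties.Inverse using (↔-refl; ↔-sym; ↔-trans; ↔⇒↣)
open import Function.Construct.Composition using (_↣-∘_; _⇔-∘_)
open import Function.Construct.Identity using (⇔-id)
open import Function.Construct.Symmetry using (⇔-sym)
open import Relation.Nullary using (Irrelevant)
open import Relation.Binary.PropositionalEquality using (_≡_; _≗_; refl; sym; trans; cong; subst₂)

private
  variable
    A B : Set
    m n : ℕ

Finite : Set → Set
Finite A = ∃[ n ] (A ↔ Fin n)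

Finite-↔ : A ↔ B → Finite A → Finite B
Finite-↔ A↔B (n , A↔n) = n , ↔-trans (↔-sym A↔B) A↔n

Finite-⊥ : Finite ⊥
Finite-⊥ = 0 , ↔-sym 0↔⊥

Finite-⊤ : Finite ⊤
Finite-⊤ = 1 , ↔-sym 1↔⊤

Finite-T : ∀ b → Finite (T b)
Finite-T true  = Finite-⊤
Finite-T false = Finite-⊥

Finite-× : Finite A → Finite B → Finite (A × B)
Finite-× (m , A↔m) (n , B↔n) = m * n , ↔-trans (A↔m ×-↔ B↔n) (↔-sym *↔×)

Finite-⊎ : Finite A → Finite B → Finite (A ⊎ B)
Finite-⊎ (m , A↔m) (n , B↔n) = m + n , ↔-trans (A↔m ⊎-↔ B↔n) (↔-sym +↔⊎)

Vec-0↔⊤ : Vec A 0 ↔ ⊤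
Vec-0↔⊤ = mk↔ₛ′ _ (λ _ → []) (λ _ → refl) (λ { [] → refl })

Vec-suc↔× : Vec A (suc n) ↔ (A × Vec A n)
Vec-suc↔× = mk↔ₛ′ (λ { (x ∷ xs) → x , xs }) (λ { (x , xs) → x ∷ xs })
                  (λ _ → refl) (λ { (x ∷ xs) → refl })

Finite-Vec : Finite A → ∀ n → Finite (Vec A n)
Finite-Vec fA zero    = Finite-↔ (↔-sym Vec-0↔⊤) Finite-⊤
Finite-Vec fA (suc n) = Finite-↔ (↔-sym Vec-suc↔×) (Finite-× fA (Finite-Vec fA n))

Σ-Fin-0↔⊥ : {B : Fin 0 → Set} → Σ (Fin 0) B ↔ ⊥
Σ-Fin-0↔⊥ = mk↔ₛ′ (λ { (() , _) }) (λ ()) (λ ()) (λ { (() , _) })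

Σ-Fin-suc↔⊎ : {B : Fin (suc n) → Set} → Σ (Fin (suc n)) B ↔ (B zero ⊎ Σ (Fin n) (B ∘ suc))
Σ-Fin-suc↔⊎ = mk↔ₛ′
  (λ { (zero , b) → inj₁ b ; (suc i , b) → inj₂ (i , b) })
  (λ { (inj₁ b) → zero , b ; (inj₂ (i , b)) → suc i , b })
  (λ { (inj₁ b) → refl ; (inj₂ _) → refl })
  (λ { (zero , _) → refl ; (suc _ , _) → refl })

Finite-Σ-Fin : {B : Fin n → Set} → (∀ i → Finite (B i)) → Finite (Σ (Fin n) B)
Finite-Σ-Fin {zero}  fB = Finite-↔ (↔-sym Σ-Fin-0↔⊥) Finite-⊥
Finite-Σ-Fin {suc n} fB =
  Finite-↔ (↔-sym Σ-Fin-suc↔⊎) (Finite-⊎ (fB zero) (Finite-Σ-Fin (fB ∘ suc)))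

Finite-Σ : {B : A → Set} → Finite A → (∀ a → Finite (B a)) → Finite (Σ A B)
Finite-Σ (n , A↔n) fB =
  Finite-↔ (Σ-↔ (↔-sym A↔n) ↔-refl) (Finite-Σ-Fin (fB ∘ Inverse.from A↔n))

Fin-↣ : m ≤ n → Fin m ↣ Fin n
Fin-↣ m≤n = mk↣ (λ {i} {j} → inject≤-injective m≤n m≤n i j)

↣⇒≤ : Fin m ↣ Fin n → m ≤ n
↣⇒≤ f = injective⇒≤ (Injection.injective f)

×-cancelˡ-↣ : {A B C : Set} → A → Finite A → Finite B → Finite C → (A × B) ↣ (A × C) → B ↣ C
×-cancelˡ-↣ {A} {B} {C} a (k , A↔k) (m , B↔m) (n , C↔n) f =
  ↔⇒↣ (↔-sym C↔n) ↣-∘ (Fin-↣ m≤n ↣-∘ ↔⇒↣ B↔m)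
  where
  km↔A×B : Fin (k * m) ↔ (A × B)
  km↔A×B = ↔-trans *↔× (↔-sym (A↔k ×-↔ B↔m))
  A×C↔kn : (A × C) ↔ Fin (k * n)
  A×C↔kn = ↔-trans (A↔k ×-↔ C↔n) (↔-sym *↔×)
  m≤n : m ≤ n
  m≤n = *-cancelˡ-≤ k {{nonZeroIndex (Inverse.to A↔k a)}}
          (↣⇒≤ (↔⇒↣ A×C↔kn ↣-∘ (f ↣-∘ ↔⇒↣ km↔A×B)))

map-↔ : A ↔ B → Vec A n ↔ Vec B n
map-↔ A↔B =
  mk↔ₛ′ (map to) (map from) (map-inverse strictlyInverseˡ) (map-inverse strictlyInverseʳ)
  where
  open Inverse A↔B
  map-inverse : ∀ {A B : Set} {f : A → B} {g : B → A} → f ∘ g ≗ (λ x → x) →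
                map {n = n} f ∘ map g ≗ (λ xs → xs)
  map-inverse {f = f} {g} fg xs = trans (sym (map-∘ f g xs)) (trans (map-cong fg xs) (map-id xs))

⇔⇒↔ : Irrelevant A → Irrelevant B → A ⇔ B → A ↔ B
⇔⇒↔ irrA irrB A⇔B = mk↔ₛ′ to from (λ _ → irrB _ _) (λ _ → irrA _ _)
  where open Equivalence A⇔B

T-×-irrelevant : ∀ {a b} → Irrelevant (T a × T b)
T-×-irrelevant (s , t) (s′ , t′) = ×-≡,≡→≡ (T-irrelevant s s′ , T-irrelevant t t′)

T-not-∨⇔→ : ∀ {a b} → T (not a ∨ b) ⇔ (T a → T b)
T-not-∨⇔→ {true}  = mk⇔ (λ t _ → t) (λ f → f _)
T-not-∨⇔→ {false} = mk⇔ (λ _ ()) (λ _ → _)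

T-allL-tabulate : (p : A → Bool) (f : Fin n → A) →
                  T (allL p (tabulate f)) ⇔ (∀ i → T (p (f i)))
T-allL-tabulate {n = zero}  p f = mk⇔ (λ _ ()) _
T-allL-tabulate {n = suc n} p f =
  uncons ⇔-∘ ((⇔-id _ ×-⇔ T-allL-tabulate p (f ∘ suc)) ⇔-∘ T-∧)
  where
  uncons : (T (p (f zero)) × (∀ i → T (p (f (suc i))))) ⇔ (∀ i → T (p (f i)))
  uncons = mk⇔ (λ { (h , t) zero → h ; (h , t) (suc i) → t i }) (λ h → h zero , h ∘ suc)

Monotone : (P R : RawFinPoset) → (Elem P → Elem R) → Set
Monotone P R f = ∀ x y → T (le P x y) → T (le R (f x) (f y))

isMono⇔Monotone : (P R : RawFinPoset) (v : Vec (Elem R) (suc (size P))) →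
                  T (isMono P R v) ⇔ Monotone P R (lookup v)
isMono⇔Monotone P R v = mk⇔
  (λ h x y → to T-not-∨⇔→ (to (rows _) (to (rows _) h x) y))
  (λ h → from (rows _) (λ x → from (rows _) (λ y → from T-not-∨⇔→ (h x y))))
  where
  open Equivalence
  rows : (p : Elem P → Bool) → T (allL p (allFin (suc (size P)))) ⇔ (∀ x → T (p x))
  rows p = T-allL-tabulate p (λ x → x)

Monotone-≗ : (P R : RawFinPoset) {f g : Elem P → Elem R} → f ≗ g →
             Monotone P R f ⇔ Monotone P R g
Monotone-≗ P R f≗g = mk⇔ (transport f≗g) (transport (sym ∘ f≗g))
  where
  transport : ∀ {f g} → f ≗ g → Monotone P R f → Monotone P R g
  transport f≗g mono x y x≤y = subst₂ (λ a b → T (le R a b)) (f≗g x) (f≗g y) (mono x y x≤y)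

module _ (P Q X : RawFinPoset) where

  private
    split : Elem (Q ×ₚ X) → Elem Q × Elem X
    split = remQuot {suc (size Q)} (suc (size X))

  Monotone-×ₚ : (f : Elem P → Elem (Q ×ₚ X)) →
                Monotone P (Q ×ₚ X) f ⇔
                (Monotone P Q (proj₁ ∘ split ∘ f) × Monotone P X (proj₂ ∘ split ∘ f))
  Monotone-×ₚ f = mk⇔
    (λ mono → (λ x y x≤y → proj₁ (to T-∧ (mono x y x≤y)))
            , (λ x y x≤y → proj₂ (to T-∧ (mono x y x≤y))))
    (λ { (mono₁ , mono₂) x y x≤y → from T-∧ (mono₁ x y x≤y , mono₂ x y x≤y) })
    where open Equivalence

  Hom-×ₚ↔ : Hom P (Q ×ₚ X) ↔ (Hom P Q × Hom P X)
  Hom-×ₚ↔ = ↔-trans (Σ-↔ components (λ {v} → monotone⇔ {v})) regroup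
    where
    V : RawFinPoset → Set
    V R = Vec (Elem R) (suc (size P))

    components : V (Q ×ₚ X) ↔ (V Q × V X)
    components = ↔-trans (map-↔ *↔×) (↔-sym ×v↔v×)

    lookup-components : ∀ v i → let (a , b) = Inverse.to components v in
                        (lookup a i , lookup b i) ≡ split (lookup v i)
    lookup-components v i = trans (lookup-unzip i (map split v)) (lookup-map i split v)

    monotone⇔ : ∀ {v} → let (a , b) = Inverse.to components v in
                T (isMono P (Q ×ₚ X) v) ↔ (T (isMono P Q a) × T (isMono P X b))
    monotone⇔ {v} = ⇔⇒↔ T-irrelevant T-×-irrelevant
      (tables ⇔-∘ (componentwise ⇔-∘
        (Monotone-×ₚ (lookup v) ⇔-∘ isMono⇔Monotone P (Q ×ₚ X) v)))
      where
      a = proj₁ (Inverse.to components v)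
      b = proj₂ (Inverse.to components v)
      componentwise :
        (Monotone P Q (proj₁ ∘ split ∘ lookup v) × Monotone P X (proj₂ ∘ split ∘ lookup v))
        ⇔ (Monotone P Q (lookup a) × Monotone P X (lookup b))
      componentwise = Monotone-≗ P Q (λ i → sym (cong proj₁ (lookup-components v i)))
                  ×-⇔ Monotone-≗ P X (λ i → sym (cong proj₂ (lookup-components v i)))
      tables : (Monotone P Q (lookup a) × Monotone P X (lookup b))
               ⇔ (T (isMono P Q a) × T (isMono P X b))
      tables = ⇔-sym (isMono⇔Monotone P Q a) ×-⇔ ⇔-sym (isMono⇔Monotone P X b)

    regroup : Σ (V Q × V X) (λ (a , b) → T (isMono P Q a) × T (isMono P X b))
              ↔ (Hom P Q × Hom P X)
    regroup = mk↔ₛ′ (λ ((a , b) , (s , t)) → (a , s) , (b , t))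
                    (λ ((a , s) , (b , t)) → (a , b) , (s , t))
                    (λ _ → refl) (λ _ → refl)

Hom-finite : (P R : RawFinPoset) → Finite (Hom P R)
Hom-finite P R = Finite-Σ (Finite-Vec (_ , ↔-refl) _) (Finite-T ∘ isMono P R)

Hom-const : (P Q : RawFinPoset) → IsPoset Q → Elem Q → Hom P Q
Hom-const P Q isQ q =
  replicate _ q , Equivalence.from (isMono⇔Monotone P Q (replicate _ q)) const-monotone
  where
  const-monotone : Monotone P Q (lookup (replicate _ q))
  const-monotone = Equivalence.to (Monotone-≗ P Q (λ x → sym (lookup-replicate x q)))
                                  (λ _ _ _ → IsPoset.reflexive isQ q)

mainTheorem6 : (Q R S : RawFinPoset) → IsPoset Q → IsPoset R → IsPoset S →
               (Q ×ₚ R) ⊑ (Q ×ₚ S) → R ⊑ S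
mainTheorem6 Q R S isQ _ _ Q×R⊑Q×S P isP = Injection.to R↣S , Injection.injective R↣S
  where
  Q×R↣Q×S : (Hom P Q × Hom P R) ↣ (Hom P Q × Hom P S)
  Q×R↣Q×S = ↔⇒↣ (Hom-×ₚ↔ P Q S)
              ↣-∘ (mk↣ (proj₂ (Q×R⊑Q×S P isP)) ↣-∘ ↔⇒↣ (↔-sym (Hom-×ₚ↔ P Q R)))
  R↣S : Hom P R ↣ Hom P S
  R↣S = ×-cancelˡ-↣ (Hom-const P Q isQ zero)
          (Hom-finite P Q) (Hom-finite P R) (Hom-finite P S) Q×R↣Q×S
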